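{- Let $x,y,r,r',S,N\in\mathbb{Z}[i]$ be nonzero with $(Sx+r)(Sy+r')=N$, $|r|,|r'|<|S|/\sqrt2$, and $|S|^3>|N|$. Then $|x|,|y|\le 5|S|$ and $|xy|<9|S|$.
   Context: $|\cdot|$ is the complex absolute value. -}

module Defs where

open import Data.Integer using (ℤ; _+_; _-_; _*_; 0ℤ)

record ℤ[i] : Set where
  constructor _+_i
  field
    re : ℤ
    im : ℤ
open ℤ[i] public

0ᵍ : ℤ[i]
0ᵍ = 0ℤ + 0ℤ i

infixl 6 _+ᵍ_
infixl 7 _*ᵍ_

_+ᵍ_ : ℤ[i] → ℤ[i] → ℤ[i]
(a + b i) +ᵍ (c + d i) = (a + c) + (b + d) i

_*ᵍ_ : ℤ[i] → ℤ[i] → ℤ[i]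
(a + b i) *ᵍ (c + d i) = (a * c - b * d) + (a * d + b * c) i

-- field norm  N(a + b i) = a² + b² = |a + b i|²  (square of the complex absolute value)
normᵍ : ℤ[i] → ℤ
normᵍ (a + b i) = a * a + b * b

-- Write n = |S|², X = |x|², A = |Sx + r|², R = |r|², all natural numbers.  The weighted
-- parallelogram law  k|w|² + |k(w + r) + r|² = k(k+1)|w + r|² + (k+1)|r|²  at w = Sx, together
-- with 2R < n, gives for k = 1 and k = 3 the lower bounds n(X − 1) < 2A and nX < 12A, and
-- likewise for y with B = |Sy + r'|².  Multiplying a lower bound for A by one for B and using
-- AB = |N|² < n³ bounds X − 1 by 24n and, when X ≥ 2 (so that nX ≤ 4A), XY by 48n.
module Submission where

open import Data.Integer.Base as ℤ using (ℤ; +_; +0; +[1+_]; -[1+_]; ∣_∣; +≤+; +<+)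
open import Data.Integer.Properties using (+-injective; pos-+; pos-*; drop‿+<+)
import Data.Integer.Tactic.RingSolver as ℤ-Solver
open import Data.List.Base using ([]; _∷_)
open import Data.Nat.Base
open import Data.Nat.Properties
open import Data.Nat.Tactic.RingSolver using (solve)
open import Data.Product.Base using (_×_; _,_)
open import Relation.Binary.PropositionalEquality
open import Relation.Nullary.Negation using (contradiction)

open import Defs

module _ where
  open ≤-Reasoning

  cube-bound : ∀ {n a b A B} c d .{{_ : NonZero c}} .{{_ : NonZero d}} →
               n * a ≤ c * A → n * b ≤ d * B → A * B < n * n * n → a * b < c * d * n
  cube-bound {n} {a} {b} {A} {B} c d na≤cA nb≤dB AB<n³ =
    *-cancelˡ-< (n * n) (a * b) (c * d * n) (begin-strict
      n * n * (a * b)     ≡⟨ solve (n ∷ a ∷ b ∷ []) ⟩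
      (n * a) * (n * b)   ≤⟨ *-mono-≤ na≤cA nb≤dB ⟩
      (c * A) * (d * B)   ≡⟨ solve (c ∷ d ∷ A ∷ B ∷ []) ⟩
      c * d * (A * B)     <⟨ *-monoʳ-< (c * d) {{m*n≢0 c d}} AB<n³ ⟩
      c * d * (n * n * n) ≡⟨ solve (c ∷ d ∷ n ∷ []) ⟩
      n * n * (c * d * n) ∎)

  WeightedTriangle : ℕ → ℕ → ℕ → Set
  WeightedTriangle W A R = ∀ k → k * W ≤ k * suc k * A + suc k * R

  record LowerBounds (n X A : ℕ) : Set where
    field
      pred-bound : n * pred X < 2 * A
      bound      : n * X < 12 * A

  open LowerBounds

  lower-bounds : ∀ {n X A R} → WeightedTriangle (n * X) A R → 2 * R < n → 0 < X →
                 LowerBounds n X A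
  lower-bounds {n} {suc X} {A} {R} tri 2R<n _ = record
    { pred-bound = +-cancelʳ-< n (n * X) (2 * A) (begin-strict
        n * X + n                           ≡⟨ solve (n ∷ X ∷ []) ⟩
        1 * (n * (1 + X))                   ≤⟨ tri 1 ⟩
        2 * A + 2 * R                       <⟨ +-monoʳ-< (2 * A) 2R<n ⟩
        2 * A + n                           ∎)
    ; bound = +-cancelʳ-< (2 * n) (n * suc X) (12 * A) (begin-strict
        n * suc X + 2 * n                   ≤⟨ m≤m+n _ (2 * (n * X)) ⟩
        n * (1 + X) + 2 * n + 2 * (n * X)   ≡⟨ solve (n ∷ X ∷ []) ⟩
        3 * (n * suc X)                     ≤⟨ tri 3 ⟩
        12 * A + 4 * R                      ≡⟨ solve (A ∷ R ∷ []) ⟩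
        12 * A + 2 * (2 * R)                <⟨ +-monoʳ-< (12 * A) (*-monoʳ-< 2 2R<n) ⟩
        12 * A + 2 * n                      ∎)
    }

  cube>0 : ∀ {m n} → m < n * n * n → 0 < n
  cube>0 {n = suc _} _ = z<s

  norm-bound : ∀ {n X Y A B} → LowerBounds n X A → LowerBounds n Y B → 0 < Y →
               A * B < n * n * n → X ≤ 25 * n
  norm-bound {X = zero} _ _ _ _ = z≤n
  norm-bound {n} {suc X} {Y} {A} {B} x y 0<Y AB<n³ = begin
    suc X       ≡⟨ cong suc (sym (*-identityʳ X)) ⟩
    suc (X * 1) ≤⟨ cube-bound {n} {X} {1} {A} {B} 2 12 (<⇒≤ (pred-bound x)) n≤12B AB<n³ ⟩
    24 * n      ≤⟨ *-monoˡ-≤ n (m≤m+n 24 1) ⟩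
    25 * n      ∎
    where
    n≤12B : n * 1 ≤ 12 * B
    n≤12B = ≤-trans (*-monoʳ-≤ n 0<Y) (<⇒≤ (bound y))

  product-bound-≥2 : ∀ {n X Y A B} → 1 < X → LowerBounds n X A → LowerBounds n Y B →
                     A * B < n * n * n → X * Y < 48 * n
  product-bound-≥2 {n} {suc X} {Y} {A} {B} (s≤s 1≤X) x y AB<n³ =
    cube-bound {n} {suc X} {Y} {A} {B} 4 12 nX≤4A (<⇒≤ (bound y)) AB<n³
    where
    nX≤4A : n * suc X ≤ 4 * A
    nX≤4A = begin
      n * suc X   ≤⟨ *-monoʳ-≤ n (+-monoˡ-≤ X 1≤X) ⟩
      n * (X + X) ≡⟨ solve (n ∷ X ∷ []) ⟩
      2 * (n * X) ≤⟨ *-monoʳ-≤ 2 (<⇒≤ (pred-bound x)) ⟩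
      2 * (2 * A) ≡⟨ solve (A ∷ []) ⟩
      4 * A       ∎

  product-bound : ∀ {n X Y A B} → 0 < X → 0 < Y → LowerBounds n X A → LowerBounds n Y B →
                  A * B < n * n * n → X * Y < 48 * n
  product-bound {X = suc (suc _)} _ _ x y AB<n³ = product-bound-≥2 (s≤s z<s) x y AB<n³
  product-bound {n} {suc zero} {Y@(suc (suc _))} {A} {B} _ _ x y AB<n³ =
    subst (_< 48 * n) (*-comm Y 1)
          (product-bound-≥2 (s≤s z<s) y x (subst (_< n * n * n) (*-comm A B) AB<n³))
  product-bound {n} {suc zero} {suc zero} _ _ _ _ AB<n³ =
    ≤-trans (s≤s (s≤s z≤n)) (m≤m*n 48 n {{>-nonZero (cube>0 AB<n³)}})

  norm-bounds : ∀ {n X Y A B} → 0 < X → 0 < Y → LowerBounds n X A → LowerBounds n Y B →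
                A * B < n * n * n → X ≤ 25 * n × Y ≤ 25 * n × X * Y < 81 * n
  norm-bounds {n} {A = A} {B} 0<X 0<Y x y AB<n³ =
    norm-bound x y 0<Y AB<n³ ,
    norm-bound y x 0<X (subst (_< n * n * n) (*-comm A B) AB<n³) ,
    <-≤-trans (product-bound 0<X 0<Y x y AB<n³) (*-monoˡ-≤ n (m≤m+n 48 33))

‖_‖ : ℤ[i] → ℕ
‖ a + b i ‖ = ∣ a ∣ * ∣ a ∣ + ∣ b ∣ * ∣ b ∣

infixr 7 _·ᵍ_

_·ᵍ_ : ℤ → ℤ[i] → ℤ[i]
k ·ᵍ (a + b i) = (k ℤ.* a) + (k ℤ.* b) i

normᵍ≡‖‖ : ∀ z → normᵍ z ≡ + ‖ z ‖
normᵍ≡‖‖ (a + b i) = begin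
  a ℤ.* a ℤ.+ b ℤ.* b                     ≡⟨ cong₂ ℤ._+_ (square a) (square b) ⟩
  + (∣ a ∣ * ∣ a ∣) ℤ.+ + (∣ b ∣ * ∣ b ∣)  ≡⟨ sym (pos-+ (∣ a ∣ * ∣ a ∣) _) ⟩
  + (∣ a ∣ * ∣ a ∣ + ∣ b ∣ * ∣ b ∣)        ∎
  where
  open ≡-Reasoning
  square : ∀ a → a ℤ.* a ≡ + (∣ a ∣ * ∣ a ∣)
  square (+ m)    = sym (pos-* m m)
  square -[1+ m ] = refl

‖z‖>0 : ∀ z → z ≢ 0ᵍ → 0 < ‖ z ‖
‖z‖>0 (+0       + +0       i) z≢0 = contradiction refl z≢0
‖z‖>0 (+[1+ _ ] + _        i) _   = z<s
‖z‖>0 (-[1+ _ ] + _        i) _   = z<s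
‖z‖>0 (+0       + +[1+ _ ] i) _   = z<s
‖z‖>0 (+0       + -[1+ _ ] i) _   = z<s

normᵍ-*ᵍ : ∀ z w → normᵍ (z *ᵍ w) ≡ normᵍ z ℤ.* normᵍ w
normᵍ-*ᵍ (a + b i) (c + d i) = two-squares a b c d
  where
  two-squares : ∀ a b c d →
    (a ℤ.* c ℤ.- b ℤ.* d) ℤ.* (a ℤ.* c ℤ.- b ℤ.* d) ℤ.+ (a ℤ.* d ℤ.+ b ℤ.* c) ℤ.* (a ℤ.* d ℤ.+ b ℤ.* c)
      ≡ (a ℤ.* a ℤ.+ b ℤ.* b) ℤ.* (c ℤ.* c ℤ.+ d ℤ.* d)
  two-squares = ℤ-Solver.solve-∀

normᵍ-weighted-parallelogram : ∀ k w r →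
  k ℤ.* normᵍ w ℤ.+ normᵍ (k ·ᵍ (w +ᵍ r) +ᵍ r)
    ≡ k ℤ.* (ℤ.1ℤ ℤ.+ k) ℤ.* normᵍ (w +ᵍ r) ℤ.+ (ℤ.1ℤ ℤ.+ k) ℤ.* normᵍ r
normᵍ-weighted-parallelogram k (a + b i) (c + d i) = identity k a b c d
  where
  identity : ∀ k a b c d →
    k ℤ.* (a ℤ.* a ℤ.+ b ℤ.* b)
      ℤ.+ ((k ℤ.* (a ℤ.+ c) ℤ.+ c) ℤ.* (k ℤ.* (a ℤ.+ c) ℤ.+ c)
           ℤ.+ (k ℤ.* (b ℤ.+ d) ℤ.+ d) ℤ.* (k ℤ.* (b ℤ.+ d) ℤ.+ d))
      ≡ k ℤ.* (ℤ.1ℤ ℤ.+ k) ℤ.* ((a ℤ.+ c) ℤ.* (a ℤ.+ c) ℤ.+ (b ℤ.+ d) ℤ.* (b ℤ.+ d))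
        ℤ.+ (ℤ.1ℤ ℤ.+ k) ℤ.* (c ℤ.* c ℤ.+ d ℤ.* d)
  identity = ℤ-Solver.solve-∀

‖‖-*ᵍ : ∀ z w → ‖ z *ᵍ w ‖ ≡ ‖ z ‖ * ‖ w ‖
‖‖-*ᵍ z w = +-injective (begin
  + ‖ z *ᵍ w ‖           ≡⟨ sym (normᵍ≡‖‖ (z *ᵍ w)) ⟩
  normᵍ (z *ᵍ w)         ≡⟨ normᵍ-*ᵍ z w ⟩
  normᵍ z ℤ.* normᵍ w    ≡⟨ cong₂ ℤ._*_ (normᵍ≡‖‖ z) (normᵍ≡‖‖ w) ⟩
  + ‖ z ‖ ℤ.* + ‖ w ‖    ≡⟨ sym (pos-* ‖ z ‖ ‖ w ‖) ⟩
  + (‖ z ‖ * ‖ w ‖)      ∎)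
  where open ≡-Reasoning

weighted-triangle : ∀ w r → WeightedTriangle (‖ w ‖) (‖ w +ᵍ r ‖) (‖ r ‖)
weighted-triangle w r k = ≤-trans (m≤m+n (k * ‖ w ‖) ‖ u ‖) (≤-reflexive (+-injective (begin
  + (k * ‖ w ‖ + ‖ u ‖)
    ≡⟨ trans (pos-+ (k * ‖ w ‖) ‖ u ‖) (cong (ℤ._+ + ‖ u ‖) (pos-* k ‖ w ‖)) ⟩
  + k ℤ.* + ‖ w ‖ ℤ.+ + ‖ u ‖
    ≡⟨ sym (cong₂ (λ p q → + k ℤ.* p ℤ.+ q) (normᵍ≡‖‖ w) (normᵍ≡‖‖ u)) ⟩
  + k ℤ.* normᵍ w ℤ.+ normᵍ u
    ≡⟨ normᵍ-weighted-parallelogram (+ k) w r ⟩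
  + k ℤ.* + suc k ℤ.* normᵍ (w +ᵍ r) ℤ.+ + suc k ℤ.* normᵍ r
    ≡⟨ cong₂ (λ p q → + k ℤ.* + suc k ℤ.* p ℤ.+ + suc k ℤ.* q) (normᵍ≡‖‖ (w +ᵍ r)) (normᵍ≡‖‖ r) ⟩
  + k ℤ.* + suc k ℤ.* + ‖ w +ᵍ r ‖ ℤ.+ + suc k ℤ.* + ‖ r ‖
    ≡⟨ cong₂ ℤ._+_ (trans (cong (ℤ._* + ‖ w +ᵍ r ‖) (sym (pos-* k (suc k))))
                          (sym (pos-* (k * suc k) ‖ w +ᵍ r ‖)))
                   (sym (pos-* (suc k) ‖ r ‖)) ⟩
  + (k * suc k * ‖ w +ᵍ r ‖) ℤ.+ + (suc k * ‖ r ‖)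
    ≡⟨ sym (pos-+ (k * suc k * ‖ w +ᵍ r ‖) (suc k * ‖ r ‖)) ⟩
  + (k * suc k * ‖ w +ᵍ r ‖ + suc k * ‖ r ‖) ∎)))
  where
  open ≡-Reasoning
  u : ℤ[i]
  u = (+ k) ·ᵍ (w +ᵍ r) +ᵍ r

*normᵍ<normᵍ⇒*‖‖<‖‖ : ∀ c z w → + c ℤ.* normᵍ z ℤ.< normᵍ w → c * ‖ z ‖ < ‖ w ‖
*normᵍ<normᵍ⇒*‖‖<‖‖ c z w h rewrite normᵍ≡‖‖ z | normᵍ≡‖‖ w | sym (pos-* c ‖ z ‖) = drop‿+<+ h

normᵍ*ᵍ<cube⇒‖‖*‖‖<cube : ∀ u v w → normᵍ (u *ᵍ v) ℤ.< normᵍ w ℤ.* normᵍ w ℤ.* normᵍ w →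
                          ‖ u ‖ * ‖ v ‖ < ‖ w ‖ * ‖ w ‖ * ‖ w ‖
normᵍ*ᵍ<cube⇒‖‖*‖‖<cube u v w h
  rewrite normᵍ≡‖‖ (u *ᵍ v) | ‖‖-*ᵍ u v | normᵍ≡‖‖ w
        | sym (pos-* ‖ w ‖ ‖ w ‖) | sym (pos-* (‖ w ‖ * ‖ w ‖) ‖ w ‖)
  = drop‿+<+ h

‖‖≤*‖‖⇒normᵍ≤*normᵍ : ∀ c z w → ‖ z ‖ ≤ c * ‖ w ‖ → normᵍ z ℤ.≤ + c ℤ.* normᵍ w
‖‖≤*‖‖⇒normᵍ≤*normᵍ c z w h rewrite normᵍ≡‖‖ z | normᵍ≡‖‖ w | sym (pos-* c ‖ w ‖) = +≤+ h

‖‖*‖‖<*‖‖⇒normᵍ*normᵍ<*normᵍ : ∀ c x y w → ‖ x ‖ * ‖ y ‖ < c * ‖ w ‖ →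
                               normᵍ x ℤ.* normᵍ y ℤ.< + c ℤ.* normᵍ w
‖‖*‖‖<*‖‖⇒normᵍ*normᵍ<*normᵍ c x y w h
  rewrite normᵍ≡‖‖ x | normᵍ≡‖‖ y | normᵍ≡‖‖ w | sym (pos-* ‖ x ‖ ‖ y ‖) | sym (pos-* c ‖ w ‖)
  = +<+ h

factor-bounds : ∀ S x r → + 2 ℤ.* normᵍ r ℤ.< normᵍ S → x ≢ 0ᵍ →
                LowerBounds (‖ S ‖) (‖ x ‖) (‖ S *ᵍ x +ᵍ r ‖)
factor-bounds S x r 2r<S x≢0 =
  lower-bounds {‖ S ‖} {‖ x ‖} {‖ S *ᵍ x +ᵍ r ‖} {‖ r ‖}
    (subst (λ W → WeightedTriangle W (‖ S *ᵍ x +ᵍ r ‖) (‖ r ‖)) (‖‖-*ᵍ S x)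
           (weighted-triangle (S *ᵍ x) r))
    (*normᵍ<normᵍ⇒*‖‖<‖‖ 2 r S 2r<S) (‖z‖>0 x x≢0)

lemma2p5 : (x y r r' S N : ℤ[i]) →
    x ≢ 0ᵍ → y ≢ 0ᵍ → r ≢ 0ᵍ → r' ≢ 0ᵍ → S ≢ 0ᵍ → N ≢ 0ᵍ →
    (S *ᵍ x +ᵍ r) *ᵍ (S *ᵍ y +ᵍ r') ≡ N →
    + 2 ℤ.* normᵍ r ℤ.< normᵍ S →
    + 2 ℤ.* normᵍ r' ℤ.< normᵍ S →
    normᵍ N ℤ.< normᵍ S ℤ.* normᵍ S ℤ.* normᵍ S →
    (normᵍ x ℤ.≤ + 25 ℤ.* normᵍ S) × (normᵍ y ℤ.≤ + 25 ℤ.* normᵍ S)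
      × (normᵍ x ℤ.* normᵍ y ℤ.< + 81 ℤ.* normᵍ S)
lemma2p5 x y r r' S _ x≢0 y≢0 _ _ _ _ refl 2r<S 2r'<S N<S³ =
  let x≤ , y≤ , xy< = norm-bounds (‖z‖>0 x x≢0) (‖z‖>0 y y≢0)
                        (factor-bounds S x r 2r<S x≢0) (factor-bounds S y r' 2r'<S y≢0)
                        (normᵍ*ᵍ<cube⇒‖‖*‖‖<cube (S *ᵍ x +ᵍ r) (S *ᵍ y +ᵍ r') S N<S³)
  in ‖‖≤*‖‖⇒normᵍ≤*normᵍ 25 x S x≤ ,
     ‖‖≤*‖‖⇒normᵍ≤*normᵍ 25 y S y≤ ,
     ‖‖*‖‖<*‖‖⇒normᵍ*normᵍ<*normᵍ 81 x y S xy<
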